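{- Let $n\geq 3$ be odd and let $K_{1,n}$ be the star with center $r$, leaves $v_0,\dots,v_{n-1}$, and edges $i=rv_i$ for $0\leq i<n$. Let $S=\{\{v_i,v_{(i+1)\bmod n}\}:0\leq i<n\}$. Then the inequality $\sum_{e\in E(K_{1,n})}x_e\geq\lceil n/2\rceil$ defines a shared facet of $\mathrm{MultC}(K_{1,n},S)$.
   Context: Given a graph $G=(V,E)$ and $S\subseteq\binom{V}{2}$, an ($S$-)multicut is a set $\delta\subseteq E$ such that for every $\{s,t\}\in S$ the nodes $s$ and $t$ lie in different components of $G-\delta$. For $F\subseteq E$, $x^F\in\mathbb{R}^E$ is its incidence vector. The multicut polytope is $\mathrm{MultC}^{\square}(G,S)=\mathrm{conv}\{x^\delta:\delta\text{ an } S\text{ -multicut}\}$ and the multicut dominant is $\mathrm{MultC}(G,S)=\mathrm{MultC}^{\square}(G,S)+\mathbb{R}^E_{\geq 0}$. A facet-defining inequality of $\mathrm{MultC}(G,S)$ defines a shared facet if it is also facet-defining for $\mathrm{MultC}^{\square}(G,S)$.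
   Formalization: The multicut dominant and multicut polytope, together with their convex weights, validity and affine dimensions, are taken in ℚ^E instead of $\mathbb{R}^E$. -}

module Defs where

open import Data.Nat as ℕ using (ℕ; zero; suc; NonZero; ⌈_/2⌉)
open import Data.Nat.DivMod using (_%_; m%n<n)
open import Data.Integer using (+_)
open import Data.Rational using (ℚ; 0ℚ; 1ℚ; _+_; _*_; _≤_; _/_)
open import Data.Fin using (Fin; zero; suc; toℕ; fromℕ<)
open import Data.Product using (Σ; _×_; _,_; ∃; proj₁; proj₂)
open import Data.Bool using (Bool; true; false; if_then_else_)
open import Data.Vec using (lookup)
open import Data.Fin.Subset using (Subset)
open import Relation.Binary.PropositionalEquality using (_≡_)
open import Relation.Nullary using (¬_)

∑ : ∀ {k} → (Fin k → ℚ) → ℚ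
∑ {zero}  f = 0ℚ
∑ {suc k} f = f zero + ∑ (λ i → f (suc i))

Vecℚ : ℕ → Set
Vecℚ d = Fin d → ℚ

_·_ : ∀ {d} → Vecℚ d → Vecℚ d → ℚ
a · x = ∑ (λ j → a j * x j)

Region : ℕ → Set₁
Region d = Vecℚ d → Set

Conv : ∀ {d} → Region d → Region d
Conv {d} X x =
  Σ ℕ λ k → Σ (Fin k → Vecℚ d) λ p → Σ (Fin k → ℚ) λ λ' →
    ((i : Fin k) → X (p i)) ×
    ((i : Fin k) → 0ℚ ≤ λ' i) ×
    (∑ λ' ≡ 1ℚ) ×
    ((j : Fin d) → x j ≡ ∑ (λ i → λ' i * p i j))

Dominant : ∀ {d} → Region d → Region d
Dominant {d} P x = Σ (Vecℚ d) λ y → P y × ((j : Fin d) → y j ≤ x j)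

AffinelyIndependent : ∀ {d m} → (Fin m → Vecℚ d) → Set
AffinelyIndependent {d} {m} p =
  (c : Fin m → ℚ) → ∑ c ≡ 0ℚ →
  ((j : Fin d) → ∑ (λ i → c i * p i j) ≡ 0ℚ) →
  (i : Fin m) → c i ≡ 0ℚ

-- AffRank P m : the maximum number of affinely independent points of P
-- is m  (i.e. dim P = m - 1, with m = 0 iff P = ∅)
AffRank : ∀ {d} → Region d → ℕ → Set
AffRank {d} P m =
  (Σ (Fin m → Vecℚ d) λ p → ((i : Fin m) → P (p i)) × AffinelyIndependent p)
  × ((q : Fin (suc m) → Vecℚ d) → ((i : Fin (suc m)) → P (q i)) →
       ¬ AffinelyIndependent q)

Valid : ∀ {d} → Region d → Vecℚ d → ℚ → Set
Valid P a b = ∀ x → P x → b ≤ a · x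

Face : ∀ {d} → Region d → Vecℚ d → ℚ → Region d
Face P a b x = P x × (a · x ≡ b)

-- a·x ≥ b is facet-defining for P : valid, and dim Face = dim P - 1
FacetDefining : ∀ {d} → Region d → Vecℚ d → ℚ → Set
FacetDefining P a b =
  Valid P a b × ∃ λ m → AffRank P (suc m) × AffRank (Face P a b) m

record Graph : Set where
  field
    V E  : ℕ
    ends : Fin E → Fin V × Fin V
open Graph public

endpoint₁ endpoint₂ : (G : Graph) → Fin (E G) → Fin (V G)
endpoint₁ G e with ends G e
... | u , _ = u
endpoint₂ G e with ends G e
... | _ , w = w

data Adj (G : Graph) (δ : Subset (E G)) : Fin (V G) → Fin (V G) → Set where
  fwd : (e : Fin (E G)) → lookup δ e ≡ false →
        Adj G δ (endpoint₁ G e) (endpoint₂ G e)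
  bwd : (e : Fin (E G)) → lookup δ e ≡ false →
        Adj G δ (endpoint₂ G e) (endpoint₁ G e)

data Connected (G : Graph) (δ : Subset (E G)) : Fin (V G) → Fin (V G) → Set where
  here : ∀ {u} → Connected G δ u u
  step : ∀ {u v w} → Adj G δ u v → Connected G δ v w → Connected G δ u w

IsMulticut : (G : Graph) {k : ℕ} (S : Fin k → Fin (V G) × Fin (V G)) →
             Subset (E G) → Set
IsMulticut G {k} S δ = (i : Fin k) → ¬ Connected G δ (proj₁ (S i)) (proj₂ (S i))

incidence : ∀ {m} → Subset m → Vecℚ m
incidence δ e = if lookup δ e then 1ℚ else 0ℚ

MulticutPoint : (G : Graph) {k : ℕ} (S : Fin k → Fin (V G) × Fin (V G)) →
                Region (E G)
MulticutPoint G S x =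
  Σ (Subset (E G)) λ δ → IsMulticut G S δ × ((e : Fin (E G)) → x e ≡ incidence δ e)

MultCBox : (G : Graph) {k : ℕ} (S : Fin k → Fin (V G) × Fin (V G)) → Region (E G)
MultCBox G S = Conv (MulticutPoint G S)

MultC : (G : Graph) {k : ℕ} (S : Fin k → Fin (V G) × Fin (V G)) → Region (E G)
MultC G S = Dominant (MultCBox G S)

SharedFacet : (G : Graph) {k : ℕ} (S : Fin k → Fin (V G) × Fin (V G)) →
              Vecℚ (E G) → ℚ → Set
SharedFacet G S a b = FacetDefining (MultC G S) a b × FacetDefining (MultCBox G S) a b

-- The star K_{1,n}: vertex 0 = centre r, vertex suc i = leaf v_i,
-- edge i = r v_i

Star : ℕ → Graph
Star n = record { V = suc n ; E = n ; ends = λ i → (zero , suc i) }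

nextMod : (n : ℕ) .{{_ : NonZero n}} → Fin n → Fin n
nextMod n i = fromℕ< (m%n<n (suc (toℕ i)) n)

StarS : (n : ℕ) .{{_ : NonZero n}} → Fin n → Fin (suc n) × Fin (suc n)
StarS n i = (suc i , suc (nextMod n i))

ones : ∀ {d} → Vecℚ d
ones _ = 1ℚ

ℕtoℚ : ℕ → ℚ
ℕtoℚ k = (+ k) / 1

-- Leaves v_i and v_{i+1} of the star are joined in K_{1,n} − δ only through the centre, so δ is
-- a multicut iff it contains edge i or edge i+1 (mod n) for every i. Counting these n pairs,
-- each edge lying in two of them, gives 2|δ| ≥ n, i.e. |δ| ≥ ⌈n/2⌉ for odd n: the inequality is
-- valid for all multicuts, hence for their convex hull and its dominant. Both polyhedra are
-- full-dimensional, since E and the sets E ∖ {i} are n + 1 affinely independent multicuts. On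
-- the hyperplane lie the n zigzag multicuts Z_t, which contain j ≤ t iff j ≡ t (mod 2) and
-- j > t iff j ≢ t (mod 2). Their incidence vectors satisfy z_t(j) + z_t(j+1) = 1 + [j = t], so
-- adding coordinates j and j + 1 of an affine dependence isolates the coefficient of Z_j; and
-- |Z_t| + |Z_{t+1}| = n + 1 together with |Z_t| ≥ ⌈n/2⌉ gives |Z_t| = ⌈n/2⌉. Gaussian
-- elimination shows that no more affinely independent points exist, in ℚ^n or on a hyperplane.
module Submission where

open import Defs
open import Algebra.Bundles using (CommutativeRing)
import Algebra.Properties.Semiring.Sum as SemiringSum
open import Data.Bool using (Bool; true; false; not; _xor_; if_then_else_)
open import Data.Bool.Properties using (not-distribˡ-xor; not-distribʳ-xor; xor-same)
open import Data.Fin using (Fin; zero; suc; toℕ; punchIn; inject₁; fromℕ; fromℕ<; _≟_)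
open import Data.Fin.Properties
  using ( ¬∀⟶∃¬; all?; punchInᵢ≢i; suc-injective; toℕ-injective; toℕ-inject₁; toℕ-fromℕ
        ; toℕ-fromℕ<; toℕ<n; toℕ≤pred[n])
open import Data.Fin.Subset using (Subset)
import Data.Integer as ℤ
import Data.Integer.Properties as ℤ
open import Data.Nat as ℕ using (ℕ; zero; suc; _≤_; _≤?_; s≤s; z≤n; NonZero; ⌈_/2⌉)
import Data.Nat.Properties as ℕ
open import Data.Nat.DivMod using (_%_; _/_; m<n⇒m%n≡m; n%n≡0; m≡m%n+[m/n]*n)
open import Data.Product using (Σ; ∃; _×_; _,_; proj₂)
open import Data.Rational
  using (ℚ; 0ℚ; 1ℚ; _+_; _*_; _-_; -_; 1/_; ≢-nonZero; nonNegative; toℚᵘ; fromℚᵘ)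
  renaming (_≤_ to _≤ℚ_; NonZero to NonZeroℚ)
import Data.Rational.Properties as ℚ
open import Data.Rational.Solver using (module +-*-Solver)
import Data.Rational.Unnormalised as ℚᵘ
import Data.Rational.Unnormalised.Properties as ℚᵘ
open import Data.Sum as Sum using (_⊎_; inj₁; inj₂)
open import Data.Vec using (lookup; tabulate)
open import Data.Vec.Properties using (lookup∘tabulate)
open import Data.Vec.Functional as Vector using (insertAt; removeAt)
open import Data.Vec.Functional.Properties using (insertAt-lookup; insertAt-punchIn)
open import Function using (_∘_)
open import Relation.Binary.PropositionalEquality
open import Relation.Nullary using (¬_; yes; no; does; contradiction)
open import Relation.Nullary.Decidable using (dec-true; dec-false)
open import Relation.Unary using (_⊆_)

open +-*-Solver using (solve; _:+_; _:*_; :-_; _:-_; _:=_; con)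

module ℚΣ = SemiringSum (CommutativeRing.semiring ℚ.+-*-commutativeRing)
module ℕΣ = SemiringSum ℕ.+-*-semiring

∑≡sum : ∀ {k} (f : Fin k → ℚ) → ∑ f ≡ ℚΣ.sum f
∑≡sum {zero}  f = refl
∑≡sum {suc k} f = cong (f zero +_) (∑≡sum (λ i → f (suc i)))

∑-cong : ∀ {k} {f g : Fin k → ℚ} → (∀ i → f i ≡ g i) → ∑ f ≡ ∑ g
∑-cong {zero}  f≗g = refl
∑-cong {suc k} f≗g = cong₂ _+_ (f≗g zero) (∑-cong (λ i → f≗g (suc i)))

∑-zero : ∀ k → ∑ {k} (λ _ → 0ℚ) ≡ 0ℚ
∑-zero k rewrite ∑≡sum {k} (λ _ → 0ℚ) = ℚΣ.sum-replicate-zero k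

∑-distrib-+ : ∀ {k} (f g : Fin k → ℚ) → ∑ (λ i → f i + g i) ≡ ∑ f + ∑ g
∑-distrib-+ f g rewrite ∑≡sum (λ i → f i + g i) | ∑≡sum f | ∑≡sum g = ℚΣ.∑-distrib-+ f g

*-distribˡ-∑ : ∀ {k} a (f : Fin k → ℚ) → a * ∑ f ≡ ∑ (λ i → a * f i)
*-distribˡ-∑ a f rewrite ∑≡sum f | ∑≡sum (λ i → a * f i) = ℚΣ.*-distribˡ-sum a f

∑-comm : ∀ {k l} (f : Fin k → Fin l → ℚ) →
  ∑ (λ i → ∑ (λ j → f i j)) ≡ ∑ (λ j → ∑ (λ i → f i j))
∑-comm f
  rewrite ∑-cong (λ i → ∑≡sum (f i))         | ∑≡sum (λ i → ℚΣ.sum (f i))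
        | ∑-cong (λ j → ∑≡sum (λ i → f i j)) | ∑≡sum (λ j → ℚΣ.sum (λ i → f i j))
        = ℚΣ.∑-comm f

∑-removeAt : ∀ {k} (f : Fin (suc k) → ℚ) p → ∑ f ≡ f p + ∑ (removeAt f p)
∑-removeAt f p rewrite ∑≡sum f | ∑≡sum (removeAt f p) = ℚΣ.sum-remove f

∑-init-last : ∀ {k} (f : Fin (suc k) → ℚ) → ∑ f ≡ ∑ (λ i → f (inject₁ i)) + f (fromℕ k)
∑-init-last f rewrite ∑≡sum f | ∑≡sum (λ i → f (inject₁ i)) = ℚΣ.sum-init-last f

∑-mono-≤ : ∀ {k} {f g : Fin k → ℚ} → (∀ i → f i ≤ℚ g i) → ∑ f ≤ℚ ∑ g
∑-mono-≤ {zero}  f≤g = ℚ.≤-refl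
∑-mono-≤ {suc k} f≤g = ℚ.+-mono-≤ (f≤g zero) (∑-mono-≤ (λ i → f≤g (suc i)))

∑-neg : ∀ {k} (f : Fin k → ℚ) → ∑ (λ i → - f i) ≡ - ∑ f
∑-neg {zero}  f = refl
∑-neg {suc k} f =
  trans (cong (- f zero +_) (∑-neg (λ i → f (suc i)))) (sym (ℚ.neg-distrib-+ (f zero) _))

∑-distrib-- : ∀ {k} (f g : Fin k → ℚ) → ∑ (λ i → f i - g i) ≡ ∑ f - ∑ g
∑-distrib-- f g = trans (∑-distrib-+ f (λ i → - g i)) (cong (∑ f +_) (∑-neg g))

∑-single : ∀ {k} (g : Fin k → ℚ) j → (∀ i → i ≢ j → g i ≡ 0ℚ) → ∑ g ≡ g j
∑-single {suc k} g j gᵢ≡0 = begin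
  ∑ g                              ≡⟨ ∑-removeAt g j ⟩
  g j + ∑ (λ i → g (punchIn j i))  ≡⟨ cong (g j +_) (trans (∑-cong gᵢ′≡0) (∑-zero k)) ⟩
  g j + 0ℚ                         ≡⟨ ℚ.+-identityʳ (g j) ⟩
  g j                              ∎
  where
  open ≡-Reasoning
  gᵢ′≡0 : ∀ i → g (punchIn j i) ≡ 0ℚ
  gᵢ′≡0 i = gᵢ≡0 _ (punchInᵢ≢i j i)

Kernel : ∀ {r s} → (Fin r → Fin s → ℚ) → (Fin s → ℚ) → Set
Kernel A c = ∀ j → ∑ (λ i → A j i * c i) ≡ 0ℚ

NonZeroVector : ∀ {s} → (Fin s → ℚ) → Set
NonZeroVector c = ∃ λ i → c i ≢ 0ℚ

zero-or-nonZero : ∀ {s} (c : Fin s → ℚ) → (∀ i → c i ≡ 0ℚ) ⊎ NonZeroVector c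
zero-or-nonZero {s} c with all? (λ i → c i ℚ.≟ 0ℚ)
... | yes c≡0 = inj₁ c≡0
... | no  c≢0 = inj₂ (¬∀⟶∃¬ s _ (λ i → c i ℚ.≟ 0ℚ) c≢0)

kernel-zeroRow : ∀ {r s} (A : Fin (suc r) → Fin (suc s) → ℚ) (d : Fin s → ℚ) →
  (∀ i → A zero i ≡ 0ℚ) → Kernel (λ j i → A (suc j) (suc i)) d → Kernel A (0ℚ Vector.∷ d)
kernel-zeroRow {s = s} A d row₀≡0 A′d≡0 zero = trans (∑-cong A₀ᵢcᵢ≡0) (∑-zero (suc s))
  where
  c = 0ℚ Vector.∷ d
  A₀ᵢcᵢ≡0 : ∀ i → A zero i * c i ≡ 0ℚ
  A₀ᵢcᵢ≡0 i = trans (cong (_* c i) (row₀≡0 i)) (ℚ.*-zeroˡ (c i))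
kernel-zeroRow A d row₀≡0 A′d≡0 (suc j) = cong₂ _+_ (ℚ.*-zeroʳ (A (suc j) zero)) (A′d≡0 j)

-- Row 0 is solved for the unknown p, which is then eliminated from the other rows.
module PivotElimination {r s} (A : Fin (suc r) → Fin (suc s) → ℚ) (p : Fin (suc s))
                        (pivot≢0 : A zero p ≢ 0ℚ) where

  instance
    pivot-nonZero : NonZeroℚ (A zero p)
    pivot-nonZero = ≢-nonZero pivot≢0

  a⁻¹ : ℚ
  a⁻¹ = 1/ (A zero p)

  reduced : Fin r → Fin s → ℚ
  reduced j i = A (suc j) (punchIn p i) - A (suc j) p * (a⁻¹ * A zero (punchIn p i))

  lift : (Fin s → ℚ) → Fin (suc s) → ℚ
  lift d = insertAt d p (- (a⁻¹ * ∑ (λ i → A zero (punchIn p i) * d i)))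

  ∑-lift : ∀ (f : Fin (suc s) → ℚ) d →
    ∑ (λ x → f x * lift d x) ≡ f p * lift d p + ∑ (λ i → f (punchIn p i) * d i)
  ∑-lift f d = trans (∑-removeAt (λ x → f x * lift d x) p)
    (cong (f p * lift d p +_) (∑-cong (λ i → cong (f (punchIn p i) *_) (insertAt-punchIn d p _ i))))

  kernel-lift : ∀ d → Kernel reduced d → Kernel A (lift d)
  kernel-lift d Bd≡0 zero = begin
    ∑ (λ x → a x * lift d x)     ≡⟨ ∑-lift a d ⟩
    a p * lift d p + S           ≡⟨ cong (λ v → a p * v + S) (insertAt-lookup d p _) ⟩
    a p * (- (a⁻¹ * S)) + S      ≡⟨ solve 3 (λ x y S → x :* (:- (y :* S)) :+ S := S :- x :* y :* S)
                                          refl (a p) a⁻¹ S ⟩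
    S - a p * a⁻¹ * S            ≡⟨ cong (λ u → S - u * S) (ℚ.*-inverseʳ (a p)) ⟩
    S - 1ℚ * S                   ≡⟨ solve 1 (λ S → S :- con 1ℚ :* S := con 0ℚ) refl S ⟩
    0ℚ                           ∎
    where
    open ≡-Reasoning
    a = A zero
    S = ∑ (λ i → a (punchIn p i) * d i)
  kernel-lift d Bd≡0 (suc j) = begin
    ∑ (λ x → A (suc j) x * lift d x)
      ≡⟨ ∑-lift (A (suc j)) d ⟩
    K * lift d p + T
      ≡⟨ cong (λ v → K * v + T) (insertAt-lookup d p _) ⟩
    K * (- (a⁻¹ * S)) + T
      ≡⟨ solve 4 (λ K y S T → K :* (:- (y :* S)) :+ T := T :+ (:- (K :* y)) :* S) refl K a⁻¹ S T ⟩
    T + - (K * a⁻¹) * S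
      ≡⟨ cong (T +_) (*-distribˡ-∑ (- (K * a⁻¹)) (λ i → A zero (punchIn p i) * d i)) ⟩
    T + ∑ (λ i → - (K * a⁻¹) * (A zero (punchIn p i) * d i))
      ≡⟨ sym (∑-distrib-+ (λ i → A (suc j) (punchIn p i) * d i) _) ⟩
    ∑ (λ i → A (suc j) (punchIn p i) * d i + - (K * a⁻¹) * (A zero (punchIn p i) * d i))
      ≡⟨ ∑-cong (λ i → reduced-term (A (suc j) (punchIn p i)) (A zero (punchIn p i)) (d i)) ⟩
    ∑ (λ i → reduced j i * d i)
      ≡⟨ Bd≡0 j ⟩
    0ℚ
      ∎
    where
    open ≡-Reasoning
    K = A (suc j) p
    S = ∑ (λ i → A zero (punchIn p i) * d i)
    T = ∑ (λ i → A (suc j) (punchIn p i) * d i)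
    reduced-term : ∀ x y z → x * z + - (K * a⁻¹) * (y * z) ≡ (x - K * (a⁻¹ * y)) * z
    reduced-term x y z = solve 5 (λ x y z k b → x :* z :+ (:- (k :* b)) :* (y :* z)
                                                  := (x :- k :* (b :* y)) :* z) refl x y z K a⁻¹

kernel-nontrivial : ∀ r (A : Fin r → Fin (suc r) → ℚ) →
  Σ (Fin (suc r) → ℚ) λ c → NonZeroVector c × Kernel A c
kernel-nontrivial zero    A = (λ _ → 1ℚ) , (zero , λ ()) , λ ()
kernel-nontrivial (suc r) A with zero-or-nonZero (A zero)
... | inj₁ row₀≡0 =
  let d , (i , dᵢ≢0) , A′d≡0 = kernel-nontrivial r (λ j i → A (suc j) (suc i))
  in  (0ℚ Vector.∷ d) , (suc i , dᵢ≢0) , kernel-zeroRow A d row₀≡0 A′d≡0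
... | inj₂ (p , pivot≢0) =
  let open PivotElimination A p pivot≢0
      d , (i , dᵢ≢0) , Bd≡0 = kernel-nontrivial r reduced
  in  lift d , (punchIn p i , subst (_≢ 0ℚ) (sym (insertAt-punchIn d p _ i)) dᵢ≢0) ,
      kernel-lift d Bd≡0

affineSystem : ∀ {d m} → (Fin m → Vecℚ d) → Fin (suc d) → Fin m → ℚ
affineSystem q zero    i = 1ℚ
affineSystem q (suc j) i = q i j

affinelyDependent : ∀ d (q : Fin (suc (suc d)) → Vecℚ d) → ¬ AffinelyIndependent q
affinelyDependent d q q-indep with kernel-nontrivial (suc d) (affineSystem q)
... | c , (i , cᵢ≢0) , Ac≡0 = cᵢ≢0 (q-indep c ∑c≡0 ∑cq≡0 i)
  where
  ∑c≡0 : ∑ c ≡ 0ℚ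
  ∑c≡0 = trans (∑-cong (λ i → sym (ℚ.*-identityˡ (c i)))) (Ac≡0 zero)
  ∑cq≡0 : ∀ j → ∑ (λ i → c i * q i j) ≡ 0ℚ
  ∑cq≡0 j = trans (∑-cong (λ i → ℚ.*-comm (c i) (q i j))) (Ac≡0 (suc j))

-- On the hyperplane ones · x ≡ b the first coordinate is determined by the others.
affinelyIndependent-tail : ∀ {d m b} (q : Fin m → Vecℚ (suc d)) → (∀ i → ones · q i ≡ b) →
  AffinelyIndependent q → AffinelyIndependent (λ i j → q i (suc j))
affinelyIndependent-tail {d} {m} {b} q onHyperplane q-indep c ∑c≡0 ∑cq′≡0 =
  q-indep c ∑c≡0 λ { zero → ∑cq₀≡0 ; (suc j) → ∑cq′≡0 j }
  where
  W : Fin m → ℚ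
  W i = ∑ (λ j → q i (suc j))
  q₀≡b-W : ∀ i → q i zero ≡ b - W i
  q₀≡b-W i = begin
    q i zero
      ≡⟨ solve 2 (λ x w → x := (con 1ℚ :* x :+ w) :- w) refl (q i zero) (W i) ⟩
    (1ℚ * q i zero + W i) - W i
      ≡⟨ cong (λ w → (1ℚ * q i zero + w) - W i) (∑-cong 1·qᵢⱼ≡qᵢⱼ) ⟩
    ones · q i - W i
      ≡⟨ cong (_- W i) (onHyperplane i) ⟩
    b - W i
      ∎
    where
    open ≡-Reasoning
    1·qᵢⱼ≡qᵢⱼ : ∀ j → q i (suc j) ≡ 1ℚ * q i (suc j)
    1·qᵢⱼ≡qᵢⱼ j = sym (ℚ.*-identityˡ (q i (suc j)))
  ∑cW≡0 : ∑ (λ i → c i * W i) ≡ 0ℚ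
  ∑cW≡0 = begin
    ∑ (λ i → c i * W i)                    ≡⟨ ∑-cong (λ i → *-distribˡ-∑ (c i) (λ j → q i (suc j))) ⟩
    ∑ (λ i → ∑ (λ j → c i * q i (suc j)))  ≡⟨ ∑-comm (λ i j → c i * q i (suc j)) ⟩
    ∑ (λ j → ∑ (λ i → c i * q i (suc j)))  ≡⟨ trans (∑-cong ∑cq′≡0) (∑-zero d) ⟩
    0ℚ                                     ∎
    where open ≡-Reasoning
  ∑cq₀≡0 : ∑ (λ i → c i * q i zero) ≡ 0ℚ
  ∑cq₀≡0 = begin
    ∑ (λ i → c i * q i zero)
      ≡⟨ ∑-cong (λ i → cong (c i *_) (q₀≡b-W i)) ⟩
    ∑ (λ i → c i * (b - W i))
      ≡⟨ ∑-cong (λ i → solve 3 (λ c b w → c :* (b :- w) := b :* c :- c :* w) refl (c i) b (W i)) ⟩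
    ∑ (λ i → b * c i - c i * W i)
      ≡⟨ ∑-distrib-- (λ i → b * c i) (λ i → c i * W i) ⟩
    ∑ (λ i → b * c i) - ∑ (λ i → c i * W i)
      ≡⟨ cong₂ _-_ (trans (sym (*-distribˡ-∑ b c)) (cong (b *_) ∑c≡0)) ∑cW≡0 ⟩
    b * 0ℚ - 0ℚ
      ≡⟨ solve 1 (λ b → b :* con 0ℚ :- con 0ℚ := con 0ℚ) refl b ⟩
    0ℚ
      ∎
    where open ≡-Reasoning

onHyperplane-affinelyDependent : ∀ d b (q : Fin (suc (suc d)) → Vecℚ (suc d)) →
  (∀ i → ones · q i ≡ b) → ¬ AffinelyIndependent q
onHyperplane-affinelyDependent d b q onHyperplane =
  affinelyDependent d (λ i j → q i (suc j)) ∘ affinelyIndependent-tail q onHyperplane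

⊆-Conv : ∀ {d} {X : Region d} → X ⊆ Conv X
⊆-Conv {x = x} x∈X =
  1 , (λ _ → x) , (λ _ → 1ℚ) , (λ _ → x∈X) , (λ _ → ℚ.nonNegative⁻¹ 1ℚ) , refl ,
  λ j → solve 1 (λ x → x := con 1ℚ :* x :+ con 0ℚ) refl (x j)

⊆-Dominant : ∀ {d} {P : Region d} → P ⊆ Dominant P
⊆-Dominant {x = x} x∈P = x , x∈P , λ j → ℚ.≤-refl

·-convexCombination : ∀ {d k} (a : Vecℚ d) (p : Fin k → Vecℚ d) (λ′ : Fin k → ℚ) x →
  (∀ j → x j ≡ ∑ (λ i → λ′ i * p i j)) → a · x ≡ ∑ (λ i → λ′ i * (a · p i))
·-convexCombination a p λ′ x x≡∑λp = begin
  ∑ (λ j → a j * x j)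
    ≡⟨ ∑-cong (λ j → cong (a j *_) (x≡∑λp j)) ⟩
  ∑ (λ j → a j * ∑ (λ i → λ′ i * p i j))
    ≡⟨ ∑-cong (λ j → *-distribˡ-∑ (a j) (λ i → λ′ i * p i j)) ⟩
  ∑ (λ j → ∑ (λ i → a j * (λ′ i * p i j)))
    ≡⟨ ∑-comm (λ j i → a j * (λ′ i * p i j)) ⟩
  ∑ (λ i → ∑ (λ j → a j * (λ′ i * p i j)))
    ≡⟨ ∑-cong (λ i → ∑-cong (λ j → swap (a j) (λ′ i) (p i j))) ⟩
  ∑ (λ i → ∑ (λ j → λ′ i * (a j * p i j)))
    ≡⟨ ∑-cong (λ i → sym (*-distribˡ-∑ (λ′ i) (λ j → a j * p i j))) ⟩
  ∑ (λ i → λ′ i * (a · p i))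
    ∎
  where
  open ≡-Reasoning
  swap : ∀ x y z → x * (y * z) ≡ y * (x * z)
  swap = solve 3 (λ x y z → x :* (y :* z) := y :* (x :* z)) refl

Valid-Conv : ∀ {d} {X : Region d} {a b} → Valid X a b → Valid (Conv X) a b
Valid-Conv {a = a} {b} valid x (k , p , λ′ , p∈X , λ′≥0 , ∑λ′≡1 , x≡∑λp) = begin
  b                           ≡⟨ sym (ℚ.*-identityʳ b) ⟩
  b * 1ℚ                      ≡⟨ cong (b *_) (sym ∑λ′≡1) ⟩
  b * ∑ λ′                    ≡⟨ *-distribˡ-∑ b λ′ ⟩
  ∑ (λ i → b * λ′ i)          ≡⟨ ∑-cong (λ i → ℚ.*-comm b (λ′ i)) ⟩
  ∑ (λ i → λ′ i * b)          ≤⟨ ∑-mono-≤ λ′b≤λ′ap ⟩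
  ∑ (λ i → λ′ i * (a · p i))  ≡⟨ sym (·-convexCombination a p λ′ x x≡∑λp) ⟩
  a · x                       ∎
  where
  open ℚ.≤-Reasoning
  λ′b≤λ′ap : ∀ i → λ′ i * b ≤ℚ λ′ i * (a · p i)
  λ′b≤λ′ap i = ℚ.*-monoˡ-≤-nonNeg (λ′ i) {{nonNegative (λ′≥0 i)}} (valid (p i) (p∈X i))

Valid-Dominant : ∀ {d} {P : Region d} {a b} → (∀ j → 0ℚ ≤ℚ a j) → Valid P a b → Valid (Dominant P) a b
Valid-Dominant {a = a} a≥0 valid x (y , y∈P , y≤x) =
  ℚ.≤-trans (valid y y∈P) (∑-mono-≤ (λ j → ℚ.*-monoˡ-≤-nonNeg (a j) {{nonNegative (a≥0 j)}} (y≤x j)))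

IndependentPoints : ∀ {d} → Region d → ℕ → Set
IndependentPoints {d} P m = Σ (Fin m → Vecℚ d) λ p → (∀ i → P (p i)) × AffinelyIndependent p

IndependentPoints-mono : ∀ {d m} {P Q : Region d} → P ⊆ Q →
  IndependentPoints P m → IndependentPoints Q m
IndependentPoints-mono P⊆Q (p , p∈P , p-indep) = p , (λ i → P⊆Q {p i} (p∈P i)) , p-indep

Face-mono : ∀ {d} {X P : Region d} {a b} → X ⊆ P → Face X a b ⊆ Face P a b
Face-mono X⊆P (x∈X , a·x≡b) = X⊆P x∈X , a·x≡b

facetDefining-ones : ∀ {d} (X : Region (suc d)) {P : Region (suc d)} {b} → X ⊆ P → Valid P ones b →
  IndependentPoints X (suc (suc d)) → IndependentPoints (Face X ones b) (suc d) →
  FacetDefining P ones b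
facetDefining-ones {d} X {P} {b} X⊆P valid full onFace =
  valid , suc d ,
  (IndependentPoints-mono {P = X} X⊆P full , λ q _ → affinelyDependent (suc d) q) ,
  (IndependentPoints-mono {P = Face X ones b} (Face-mono {X = X} {P} {ones} {b} X⊆P) onFace ,
   λ q q∈F → onHyperplane-affinelyDependent d b q (proj₂ ∘ q∈F))

-- ℕtoℚ a is the gcd-normalised fraction + a / 1, so addition is transported from ℚᵘ.
ℕtoℚ-+ : ∀ a b → ℕtoℚ (a ℕ.+ b) ≡ ℕtoℚ a + ℕtoℚ b
ℕtoℚ-+ a b = begin
  ℕtoℚ (a ℕ.+ b)                   ≡⟨ ℚ.fromℚᵘ-cong (ℚᵘ.≃-sym toℚᵘ-sum) ⟩
  fromℚᵘ (toℚᵘ (ℕtoℚ a + ℕtoℚ b))  ≡⟨ ℚ.fromℚᵘ-toℚᵘ _ ⟩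
  ℕtoℚ a + ℕtoℚ b                  ∎
  where
  open ≡-Reasoning
  [_]ᵘ : ℕ → ℚᵘ.ℚᵘ
  [ x ]ᵘ = ℚᵘ.mkℚᵘ (ℤ.+ x) 0
  +ᵘ-homo : [ a ]ᵘ ℚᵘ.+ [ b ]ᵘ ℚᵘ.≃ [ a ℕ.+ b ]ᵘ
  +ᵘ-homo = ℚᵘ.*≡* (begin
    (ℤ.+ a ℤ.* ℤ.+ 1 ℤ.+ ℤ.+ b ℤ.* ℤ.+ 1) ℤ.* ℤ.+ 1
      ≡⟨ ℤ.*-identityʳ _ ⟩
    ℤ.+ a ℤ.* ℤ.+ 1 ℤ.+ ℤ.+ b ℤ.* ℤ.+ 1
      ≡⟨ cong₂ ℤ._+_ (ℤ.*-identityʳ (ℤ.+ a)) (ℤ.*-identityʳ (ℤ.+ b)) ⟩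
    ℤ.+ a ℤ.+ ℤ.+ b
      ≡⟨ sym (ℤ.pos-+ a b) ⟩
    ℤ.+ (a ℕ.+ b)
      ≡⟨ sym (ℤ.*-identityʳ _) ⟩
    ℤ.+ (a ℕ.+ b) ℤ.* ℤ.+ 1
      ∎)
  toℚᵘ-sum : toℚᵘ (ℕtoℚ a + ℕtoℚ b) ℚᵘ.≃ [ a ℕ.+ b ]ᵘ
  toℚᵘ-sum = ℚᵘ.≃-trans (ℚ.toℚᵘ-homo-+ (ℕtoℚ a) (ℕtoℚ b))
               (ℚᵘ.≃-trans (ℚᵘ.+-cong (ℚ.toℚᵘ-fromℚᵘ [ a ]ᵘ) (ℚ.toℚᵘ-fromℚᵘ [ b ]ᵘ)) +ᵘ-homo)

ℕtoℚ-mono-≤ : ∀ {a b} → a ≤ b → ℕtoℚ a ≤ℚ ℕtoℚ b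
ℕtoℚ-mono-≤ {a} {b} a≤b = begin
  ℕtoℚ a                   ≡⟨ sym (ℚ.+-identityʳ (ℕtoℚ a)) ⟩
  ℕtoℚ a + 0ℚ              ≤⟨ ℚ.+-monoʳ-≤ (ℕtoℚ a) (ℚ.nonNegative⁻¹ _ {{ℚ.normalize-nonNeg (b ℕ.∸ a) 1}}) ⟩
  ℕtoℚ a + ℕtoℚ (b ℕ.∸ a)  ≡⟨ sym (ℕtoℚ-+ a (b ℕ.∸ a)) ⟩
  ℕtoℚ (a ℕ.+ (b ℕ.∸ a))   ≡⟨ cong ℕtoℚ (ℕ.m+[n∸m]≡n a≤b) ⟩
  ℕtoℚ b                   ∎
  where open ℚ.≤-Reasoning

sum≡double⇒≡ : ∀ {a b c} → a + b ≡ c + c → c ≤ℚ a → c ≤ℚ b → a ≡ c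
sum≡double⇒≡ {a} {b} {c} a+b≡c+c c≤a c≤b with a ℚ.≤? c
... | yes a≤c = ℚ.≤-antisym a≤c c≤a
... | no  a≰c = contradiction (ℚ.+-mono-<-≤ (ℚ.≰⇒> a≰c) c≤b) (ℚ.<-irrefl (sym a+b≡c+c))

𝟙 : Bool → ℚ
𝟙 b = if b then 1ℚ else 0ℚ

𝟙ℕ : Bool → ℕ
𝟙ℕ b = if b then 1 else 0

count : ∀ {n} → (Fin n → Bool) → ℕ
count b = ℕΣ.sum (λ i → 𝟙ℕ (b i))

count-true : ∀ n → count {n} (λ _ → true) ≡ n
count-true zero    = refl
count-true (suc n) = cong suc (count-true n)

ones·𝟙≡count : ∀ {n} (b : Fin n → Bool) → ones · (λ i → 𝟙 (b i)) ≡ ℕtoℚ (count b)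
ones·𝟙≡count {zero}  b = refl
ones·𝟙≡count {suc n} b = begin
  1ℚ * 𝟙 (b zero) + ones · (λ i → 𝟙 (b (suc i)))
    ≡⟨ cong₂ _+_ (𝟙≡ℕtoℚ (b zero)) (ones·𝟙≡count (λ i → b (suc i))) ⟩
  ℕtoℚ (𝟙ℕ (b zero)) + ℕtoℚ (count (λ i → b (suc i)))
    ≡⟨ sym (ℕtoℚ-+ (𝟙ℕ (b zero)) _) ⟩
  ℕtoℚ (count b)
    ∎
  where
  open ≡-Reasoning
  𝟙≡ℕtoℚ : ∀ x → 1ℚ * 𝟙 x ≡ ℕtoℚ (𝟙ℕ x)
  𝟙≡ℕtoℚ true  = refl
  𝟙≡ℕtoℚ false = refl

𝟙-not : ∀ x → 𝟙 (not x) ≡ 1ℚ - 𝟙 x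
𝟙-not true  = refl
𝟙-not false = refl

𝟙+𝟙-not : ∀ x → 𝟙 x + 𝟙 (not x) ≡ 1ℚ
𝟙+𝟙-not true  = refl
𝟙+𝟙-not false = refl

∑-indicator : ∀ {k} (f : Fin k → ℚ) (b : Fin k → Bool) j → b j ≡ true → (∀ i → i ≢ j → b i ≡ false) →
  ∑ (λ i → f i * 𝟙 (b i)) ≡ f j
∑-indicator f b j bⱼ≡true bᵢ≡false = begin
  ∑ (λ i → f i * 𝟙 (b i))  ≡⟨ ∑-single _ j fᵢbᵢ≡0 ⟩
  f j * 𝟙 (b j)            ≡⟨ cong (λ x → f j * 𝟙 x) bⱼ≡true ⟩
  f j * 1ℚ                 ≡⟨ ℚ.*-identityʳ (f j) ⟩
  f j                      ∎
  where
  open ≡-Reasoning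
  fᵢbᵢ≡0 : ∀ i → i ≢ j → f i * 𝟙 (b i) ≡ 0ℚ
  fᵢbᵢ≡0 i i≢j = trans (cong (λ x → f i * 𝟙 x) (bᵢ≡false i i≢j)) (ℚ.*-zeroʳ (f i))

∑-indicator-≟ : ∀ {k} (f : Fin k → ℚ) j → ∑ (λ i → f i * 𝟙 (does (i ≟ j))) ≡ f j
∑-indicator-≟ f j =
  ∑-indicator f (λ i → does (i ≟ j)) j (dec-true (j ≟ j) refl) (λ i → dec-false (i ≟ j))

∑-indicator-toℕ : ∀ {k} (f : Fin k → ℚ) j {x} → toℕ j ≡ x →
  ∑ (λ i → f i * 𝟙 (does (toℕ i ℕ.≟ x))) ≡ f j
∑-indicator-toℕ f j refl = ∑-indicator f (λ i → does (toℕ i ℕ.≟ toℕ j)) j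
  (dec-true (toℕ j ℕ.≟ toℕ j) refl) (λ i i≢j → dec-false (toℕ i ℕ.≟ toℕ j) (i≢j ∘ toℕ-injective))

∑-allBut : ∀ {k} (f : Fin k → ℚ) j → ∑ (λ i → f i * 𝟙 (not (does (i ≟ j)))) ≡ ∑ f - f j
∑-allBut f j = begin
  ∑ (λ i → f i * 𝟙 (not (δ i)))  ≡⟨ ∑-cong (λ i → cong (f i *_) (𝟙-not (δ i))) ⟩
  ∑ (λ i → f i * (1ℚ - 𝟙 (δ i)))  ≡⟨ ∑-cong (λ i → distrib (f i) (𝟙 (δ i))) ⟩
  ∑ (λ i → f i - f i * 𝟙 (δ i))   ≡⟨ ∑-distrib-- f (λ i → f i * 𝟙 (δ i)) ⟩
  ∑ f - ∑ (λ i → f i * 𝟙 (δ i))   ≡⟨ cong (λ x → ∑ f - x) (∑-indicator-≟ f j) ⟩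
  ∑ f - f j                       ∎
  where
  open ≡-Reasoning
  δ = λ i → does (i ≟ j)
  distrib : ∀ x y → x * (1ℚ - y) ≡ x - x * y
  distrib = solve 2 (λ x y → x :* (con 1ℚ :- y) := x :- x :* y) refl

data InitLast {m : ℕ} : Fin (suc m) → Set where
  init : (j : Fin m) → InitLast (inject₁ j)
  last : InitLast (fromℕ m)

initLast : ∀ {m} (i : Fin (suc m)) → InitLast i
initLast {zero}  zero    = last
initLast {suc m} zero    = init zero
initLast {suc m} (suc i) with initLast i
... | init j = init (suc j)
... | last   = last

nextMod-inject₁ : ∀ m (j : Fin m) → nextMod (suc m) (inject₁ j) ≡ suc j
nextMod-inject₁ m j = toℕ-injective (begin
  toℕ (nextMod (suc m) (inject₁ j))  ≡⟨ toℕ-fromℕ< _ ⟩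
  suc (toℕ (inject₁ j)) % suc m      ≡⟨ cong (λ x → suc x % suc m) (toℕ-inject₁ j) ⟩
  suc (toℕ j) % suc m                ≡⟨ m<n⇒m%n≡m (s≤s (toℕ<n j)) ⟩
  suc (toℕ j)                        ∎)
  where open ≡-Reasoning

nextMod-fromℕ : ∀ m → nextMod (suc m) (fromℕ m) ≡ zero
nextMod-fromℕ m = toℕ-injective (begin
  toℕ (nextMod (suc m) (fromℕ m))  ≡⟨ toℕ-fromℕ< _ ⟩
  suc (toℕ (fromℕ m)) % suc m      ≡⟨ cong (λ x → suc x % suc m) (toℕ-fromℕ m) ⟩
  suc m % suc m                    ≡⟨ n%n≡0 (suc m) ⟩
  0                                ∎)
  where open ≡-Reasoning

nextMod-irreflexive : ∀ m (i : Fin (suc (suc m))) → nextMod (suc (suc m)) i ≢ i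
nextMod-irreflexive m i next≡i with initLast i
... | init j =
  ℕ.1+n≢n (trans (cong toℕ (trans (sym (nextMod-inject₁ (suc m) j)) next≡i)) (toℕ-inject₁ j))
... | last with () ← trans (sym (nextMod-fromℕ (suc m))) next≡i

sum-mono-≤ : ∀ {n} {f g : Fin n → ℕ} → (∀ i → f i ≤ g i) → ℕΣ.sum f ≤ ℕΣ.sum g
sum-mono-≤ {zero}  f≤g = z≤n
sum-mono-≤ {suc n} f≤g = ℕ.+-mono-≤ (f≤g zero) (sum-mono-≤ (λ i → f≤g (suc i)))

sum-rotate : ∀ m (f : Fin (suc m) → ℕ) → ℕΣ.sum (λ i → f (nextMod (suc m) i)) ≡ ℕΣ.sum f
sum-rotate m f = begin
  ℕΣ.sum (f ∘ next)
    ≡⟨ ℕΣ.sum-init-last (f ∘ next) ⟩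
  ℕΣ.sum (λ j → f (next (inject₁ j))) ℕ.+ f (next (fromℕ m))
    ≡⟨ cong₂ ℕ._+_ (ℕΣ.sum-cong-≗ (cong f ∘ nextMod-inject₁ m)) (cong f (nextMod-fromℕ m)) ⟩
  ℕΣ.sum (λ j → f (suc j)) ℕ.+ f zero
    ≡⟨ ℕ.+-comm _ (f zero) ⟩
  ℕΣ.sum f
    ∎
  where
  open ≡-Reasoning
  next = nextMod (suc m)

CyclicCover : ∀ n .{{_ : NonZero n}} → (Fin n → Bool) → Set
CyclicCover n b = ∀ i → b i ≡ true ⊎ b (nextMod n i) ≡ true

CyclicCover-resp-≗ : ∀ {n} .{{_ : NonZero n}} {b b′ : Fin n → Bool} → (∀ i → b i ≡ b′ i) →
  CyclicCover n b → CyclicCover n b′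
CyclicCover-resp-≗ b≗b′ cover i = Sum.map (trans (sym (b≗b′ i))) (trans (sym (b≗b′ _))) (cover i)

-- Each of the n cyclically consecutive pairs contains an element of the cover,
-- and each element lies in exactly two of the pairs.
cyclicCover-count : ∀ m (b : Fin (suc m) → Bool) → CyclicCover (suc m) b → suc m ≤ count b ℕ.+ count b
cyclicCover-count m b cover = begin
  suc m                                  ≡⟨ sym (count-true (suc m)) ⟩
  count {suc m} (λ _ → true)             ≤⟨ sum-mono-≤ pair≥1 ⟩
  ℕΣ.sum (λ i → [b] i ℕ.+ [b] (next i))  ≡⟨ ℕΣ.∑-distrib-+ [b] ([b] ∘ next) ⟩
  count b ℕ.+ ℕΣ.sum ([b] ∘ next)        ≡⟨ cong (count b ℕ.+_) (sum-rotate m [b]) ⟩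
  count b ℕ.+ count b                    ∎
  where
  open ℕ.≤-Reasoning
  next = nextMod (suc m)
  [b] = λ i → 𝟙ℕ (b i)
  pair≥1 : ∀ i → 1 ≤ [b] i ℕ.+ [b] (next i)
  pair≥1 i with cover i
  ... | inj₁ bᵢ≡true rewrite bᵢ≡true = s≤s z≤n
  ... | inj₂ bⱼ≡true rewrite bⱼ≡true = ℕ.m≤n+m 1 ([b] i)

cyclicCover-count-odd : ∀ k (b : Fin (suc (k ℕ.+ k)) → Bool) → CyclicCover _ b → suc k ≤ count b
cyclicCover-count-odd k b cover =
  ℕ.≰⇒> λ c≤k → ℕ.<⇒≱ (cyclicCover-count (k ℕ.+ k) b cover) (ℕ.+-mono-≤ c≤k c≤k)

module _ {n} (δ : Subset n) where

  JoinedToCentre : Fin (suc n) → Set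
  JoinedToCentre v = v ≡ zero ⊎ ∃ λ e → v ≡ suc e × lookup δ e ≡ false

  adj-joinedToCentre : ∀ {u v} → Adj (Star n) δ u v → JoinedToCentre v
  adj-joinedToCentre (fwd e δₑ≡false) = inj₂ (e , refl , δₑ≡false)
  adj-joinedToCentre (bwd e δₑ≡false) = inj₁ refl

  connected-joinedToCentre : ∀ {u w} → Connected (Star n) δ u w → JoinedToCentre u → JoinedToCentre w
  connected-joinedToCentre here           u↓ = u↓
  connected-joinedToCentre (step u∼v v⋯w) _  = connected-joinedToCentre v⋯w (adj-joinedToCentre u∼v)

  connected-leaf : ∀ {e w} → Connected (Star n) δ (suc e) w →
    w ≡ suc e ⊎ (lookup δ e ≡ false × JoinedToCentre w)
  connected-leaf here                        = inj₁ refl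
  connected-leaf (step (bwd e δₑ≡false) r⋯w) =
    inj₂ (δₑ≡false , connected-joinedToCentre r⋯w (inj₁ refl))

multicut⇒cyclicCover : ∀ {n} .{{_ : NonZero n}} (δ : Subset n) →
  IsMulticut (Star n) (StarS n) δ → CyclicCover n (lookup δ)
multicut⇒cyclicCover {n} δ multicut i with lookup δ i in δᵢ | lookup δ (nextMod n i) in δⱼ
... | true  | _     = inj₁ refl
... | false | true  = inj₂ refl
... | false | false = contradiction (step (bwd i δᵢ) (step (fwd (nextMod n i) δⱼ) here)) (multicut i)

cyclicCover⇒multicut : ∀ m (δ : Subset (suc (suc m))) →
  CyclicCover _ (lookup δ) → IsMulticut (Star _) (StarS _) δ
cyclicCover⇒multicut m δ cover i vᵢ⋯vⱼ with connected-leaf δ vᵢ⋯vⱼ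
... | inj₁ vⱼ≡vᵢ = nextMod-irreflexive m i (suc-injective vⱼ≡vᵢ)
... | inj₂ (δᵢ≡false , inj₂ (_ , refl , δⱼ≡false)) with cover i
...   | inj₁ δᵢ≡true = contradiction (trans (sym δᵢ≡true) δᵢ≡false) λ ()
...   | inj₂ δⱼ≡true = contradiction (trans (sym δⱼ≡true) δⱼ≡false) λ ()

cyclicCover⇒multicutPoint : ∀ m (b : Fin (suc (suc m)) → Bool) → CyclicCover _ b →
  MulticutPoint (Star _) (StarS _) (λ e → 𝟙 (b e))
cyclicCover⇒multicutPoint m b cover =
  tabulate b ,
  cyclicCover⇒multicut m (tabulate b) (CyclicCover-resp-≗ (λ i → sym (lookup∘tabulate b i)) cover) ,
  λ e → cong 𝟙 (sym (lookup∘tabulate b e))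

multicutPoint-valid : ∀ k → Valid (MulticutPoint (Star (suc (k ℕ.+ k))) (StarS _)) ones (ℕtoℚ (suc k))
multicutPoint-valid k x (δ , multicut , x≡δ) = begin
  ℕtoℚ (suc k)             ≤⟨ ℕtoℚ-mono-≤ (cyclicCover-count-odd k (lookup δ) cover) ⟩
  ℕtoℚ (count (lookup δ))  ≡⟨ sym (ones·𝟙≡count (lookup δ)) ⟩
  ones · incidence δ       ≡⟨ ∑-cong (λ e → cong (1ℚ *_) (sym (x≡δ e))) ⟩
  ones · x                 ∎
  where
  open ℚ.≤-Reasoning
  cover = multicut⇒cyclicCover δ multicut

module AllButOne (m : ℕ) where

  n : ℕ
  n = suc (suc m)

  allButOne : Fin (suc n) → Fin n → Bool
  allButOne zero    e = true
  allButOne (suc i) e = not (does (i ≟ e))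

  allButOne-cover : ∀ i → CyclicCover n (allButOne i)
  allButOne-cover zero    e = inj₁ refl
  allButOne-cover (suc i) e with i ≟ e
  ... | no  _    = inj₁ refl
  ... | yes refl with i ≟ nextMod n i
  ...   | no  _      = inj₂ refl
  ...   | yes i≡next = contradiction (sym i≡next) (nextMod-irreflexive m i)

  allButOne-independent : AffinelyIndependent (λ i e → 𝟙 (allButOne i e))
  allButOne-independent c ∑c≡0 coordinate≡0 = c≡0
    where
    c′ : Fin n → ℚ
    c′ i = c (suc i)
    c′≡0 : ∀ e → c′ e ≡ 0ℚ
    c′≡0 e = begin
      c′ e
        ≡⟨ solve 3 (λ c₀ s x → x := (c₀ :+ s) :- (c₀ :* con 1ℚ :+ (s :- x)))
                 refl (c zero) (∑ c′) (c′ e) ⟩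
      ∑ c - (c zero * 1ℚ + (∑ c′ - c′ e))
        ≡⟨ cong₂ _-_ ∑c≡0 (trans (cong (c zero * 1ℚ +_) (sym (∑-allBut c′ e))) (coordinate≡0 e)) ⟩
      0ℚ - 0ℚ
        ≡⟨⟩
      0ℚ
        ∎
      where open ≡-Reasoning
    c≡0 : ∀ i → c i ≡ 0ℚ
    c≡0 (suc e) = c′≡0 e
    c≡0 zero    = begin
      c zero       ≡⟨ sym (ℚ.+-identityʳ (c zero)) ⟩
      c zero + 0ℚ  ≡⟨ cong (c zero +_) (sym (trans (∑-cong c′≡0) (∑-zero n))) ⟩
      ∑ c          ≡⟨ ∑c≡0 ⟩
      0ℚ           ∎
      where open ≡-Reasoning

  allButOne-points : IndependentPoints (MulticutPoint (Star n) (StarS n)) (suc n)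
  allButOne-points =
    (λ i e → 𝟙 (allButOne i e)) ,
    (λ i → cyclicCover⇒multicutPoint m (allButOne i) (allButOne-cover i)) ,
    allButOne-independent

odd : ℕ → Bool
odd zero    = false
odd (suc n) = not (odd n)

odd-double : ∀ k → odd (k ℕ.+ k) ≡ false
odd-double zero    = refl
odd-double (suc k) = cong not (trans (cong odd (ℕ.+-suc k k)) (cong not (odd-double k)))

does-suc≤? : ∀ {j t} → j ≢ t → does (suc j ≤? t) ≡ does (j ≤? t)
does-suc≤? {j} {t} j≢t with j ≤? t
... | yes j≤t = trans (dec-true (suc j ≤? t) (ℕ.≤∧≢⇒< j≤t j≢t)) (sym (dec-true (j ≤? t) j≤t))
... | no  j≰t = trans (dec-false (suc j ≤? t) (j≰t ∘ ℕ.<⇒≤)) (sym (dec-false (j ≤? t) j≰t))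

does-≤?suc : ∀ {j t} → j ≢ suc t → does (j ≤? suc t) ≡ does (j ≤? t)
does-≤?suc {j} {t} j≢t+1 with j ≤? t
... | yes j≤t = trans (dec-true (j ≤? suc t) (ℕ.m≤n⇒m≤1+n j≤t)) (sym (dec-true (j ≤? t) j≤t))
... | no  j≰t = trans (dec-false (j ≤? suc t) (j≰t ∘ ℕ.m<1+n⇒m≤n ∘ λ j≤t+1 → ℕ.≤∧≢⇒< j≤t+1 j≢t+1))
                      (sym (dec-false (j ≤? t) j≰t))

-- j ∈ Z_t iff j ≤ t and j ≡ t (mod 2), or j > t and j ≢ t (mod 2).
zigzag : ℕ → ℕ → Bool
zigzag t j = does (j ≤? t) xor (odd j xor odd t)

zigzag-diag : ∀ t → zigzag t t ≡ true
zigzag-diag t = cong₂ _xor_ (dec-true (t ≤? t) ℕ.≤-refl) (xor-same (odd t))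

zigzag-suc-diag : ∀ t → zigzag t (suc t) ≡ true
zigzag-suc-diag t =
  cong₂ _xor_ (dec-false (suc t ≤? t) ℕ.1+n≰n)
              (trans (sym (not-distribˡ-xor (odd t) (odd t))) (cong not (xor-same (odd t))))

zigzag-step : ∀ {t j} → j ≢ t → zigzag t (suc j) ≡ not (zigzag t j)
zigzag-step {t} {j} j≢t = begin
  does (suc j ≤? t) xor (not (odd j) xor odd t)
    ≡⟨ cong₂ _xor_ (does-suc≤? j≢t) (sym (not-distribˡ-xor (odd j) (odd t))) ⟩
  does (j ≤? t) xor not (odd j xor odd t)
    ≡⟨ sym (not-distribʳ-xor (does (j ≤? t)) _) ⟩
  not (zigzag t j)
    ∎
  where open ≡-Reasoning

zigzag-shift : ∀ {s j} → j ≢ suc s → zigzag (suc s) j ≡ not (zigzag s j)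
zigzag-shift {s} {j} j≢s+1 = begin
  does (j ≤? suc s) xor (odd j xor not (odd s))
    ≡⟨ cong₂ _xor_ (does-≤?suc j≢s+1) (sym (not-distribʳ-xor (odd j) (odd s))) ⟩
  does (j ≤? s) xor not (odd j xor odd s)
    ≡⟨ sym (not-distribʳ-xor (does (j ≤? s)) _) ⟩
  not (zigzag s j)
    ∎
  where open ≡-Reasoning

zigzag-consecutive : ∀ t j → zigzag t j ≡ true ⊎ zigzag t (suc j) ≡ true
zigzag-consecutive t j with j ℕ.≟ t
... | yes refl = inj₁ (zigzag-diag t)
... | no  j≢t with zigzag t j in zᵢ
...   | true  = inj₁ refl
...   | false = inj₂ (trans (zigzag-step j≢t) (cong not zᵢ))

zigzag-wrap : ∀ k x → x ≤ k ℕ.+ k → zigzag x (k ℕ.+ k) ≡ true ⊎ zigzag x 0 ≡ true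
zigzag-wrap k x x≤2k with ℕ.m≤n⇒m<n∨m≡n x≤2k
... | inj₂ refl = inj₁ (zigzag-diag x)
... | inj₁ x<2k = Sum.map₁ (trans zₓ) (b-or-not-b (odd x))
  where
  zₓ : zigzag x (k ℕ.+ k) ≡ odd x
  zₓ = cong₂ _xor_ (dec-false (k ℕ.+ k ≤? x) (ℕ.<⇒≱ x<2k)) (cong (_xor odd x) (odd-double k))
  b-or-not-b : ∀ b → b ≡ true ⊎ not b ≡ true
  b-or-not-b true  = inj₁ refl
  b-or-not-b false = inj₂ refl

𝟙-zigzag-consecutive : ∀ t j → 𝟙 (zigzag t j) + 𝟙 (zigzag t (suc j)) ≡ 1ℚ + 𝟙 (does (t ℕ.≟ j))
𝟙-zigzag-consecutive t j with t ℕ.≟ j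
... | yes refl = trans (cong₂ (λ x y → 𝟙 x + 𝟙 y) (zigzag-diag t) (zigzag-suc-diag t))
                       (cong (λ x → 1ℚ + 𝟙 x) (sym (dec-true (t ℕ.≟ t) refl)))
... | no  t≢j  = trans (cong (λ x → 𝟙 (zigzag t j) + 𝟙 x) (zigzag-step (t≢j ∘ sym)))
                       (trans (𝟙+𝟙-not (zigzag t j))
                              (cong (λ x → 1ℚ + 𝟙 x) (sym (dec-false (t ℕ.≟ j) t≢j))))

𝟙-zigzag-shift : ∀ s j → 𝟙 (zigzag s j) + 𝟙 (zigzag (suc s) j) ≡ 1ℚ + 𝟙 (does (j ℕ.≟ suc s))
𝟙-zigzag-shift s j with j ℕ.≟ suc s
... | yes refl  = trans (cong₂ (λ x y → 𝟙 x + 𝟙 y) (zigzag-suc-diag s) (zigzag-diag (suc s)))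
                        (cong (λ x → 1ℚ + 𝟙 x) (sym (dec-true (suc s ℕ.≟ suc s) refl)))
... | no  j≢s+1 = trans (cong (λ x → 𝟙 (zigzag s j) + 𝟙 x) (zigzag-shift j≢s+1))
                        (trans (𝟙+𝟙-not (zigzag s j))
                               (cong (λ x → 1ℚ + 𝟙 x) (sym (dec-false (j ℕ.≟ suc s) j≢s+1))))

module Zigzag (k′ : ℕ) where

  k m n : ℕ
  k = suc k′
  m = k ℕ.+ k
  n = suc m

  zigzagCut : ℕ → Fin n → Bool
  zigzagCut x e = zigzag x (toℕ e)

  ZigzagPair : ℕ → ℕ → ℕ → Set
  ZigzagPair x a b = zigzag x a ≡ true ⊎ zigzag x b ≡ true

  zigzagCover : ∀ x → x ≤ m → CyclicCover n (zigzagCut x)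
  zigzagCover x x≤m e with initLast e
  ... | init j = subst₂ (ZigzagPair x) (sym (toℕ-inject₁ j)) (cong toℕ (sym (nextMod-inject₁ m j)))
                        (zigzag-consecutive x (toℕ j))
  ... | last   = subst₂ (ZigzagPair x) (sym (toℕ-fromℕ m)) (cong toℕ (sym (nextMod-fromℕ m)))
                        (zigzag-wrap k x x≤m)

  point : ℕ → Fin n → ℚ
  point x e = 𝟙 (zigzagCut x e)

  size : ℕ → ℚ
  size x = ones · point x

  size-lower : ∀ x → x ≤ m → ℕtoℚ (suc k) ≤ℚ size x
  size-lower x x≤m = begin
    ℕtoℚ (suc k)                ≤⟨ ℕtoℚ-mono-≤ (cyclicCover-count-odd k (zigzagCut x) cover) ⟩
    ℕtoℚ (count (zigzagCut x))  ≡⟨ sym (ones·𝟙≡count (zigzagCut x)) ⟩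
    size x                      ∎
    where
    open ℚ.≤-Reasoning
    cover = zigzagCover x x≤m

  size-pair : ∀ s → suc s ≤ m → size s + size (suc s) ≡ ℕtoℚ (suc k) + ℕtoℚ (suc k)
  size-pair s s<m = begin
    size s + size (suc s)
      ≡⟨ sym (∑-distrib-+ (λ e → 1ℚ * point s e) (λ e → 1ℚ * point (suc s) e)) ⟩
    ∑ (λ e → 1ℚ * point s e + 1ℚ * point (suc s) e)
      ≡⟨ ∑-cong (λ e → cong₂ _+_ (ℚ.*-identityˡ (point s e)) (ℚ.*-identityˡ (point (suc s) e))) ⟩
    ∑ (λ e → point s e + point (suc s) e)
      ≡⟨ ∑-cong {n} (λ e → 𝟙-zigzag-shift s (toℕ e)) ⟩
    ∑ (λ e → 1ℚ + δ e)
      ≡⟨ ∑-distrib-+ (λ _ → 1ℚ) δ ⟩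
    ∑ (λ (_ : Fin n) → 1ℚ) + ∑ δ
      ≡⟨ cong₂ _+_ (ones·𝟙≡count {n} (λ _ → true)) ∑δ≡1 ⟩
    ℕtoℚ (count {n} (λ _ → true)) + 1ℚ
      ≡⟨ cong (λ x → ℕtoℚ x + 1ℚ) (count-true n) ⟩
    ℕtoℚ n + ℕtoℚ 1
      ≡⟨ sym (ℕtoℚ-+ n 1) ⟩
    ℕtoℚ (n ℕ.+ 1)
      ≡⟨ cong ℕtoℚ (trans (ℕ.+-comm n 1) (cong suc (sym (ℕ.+-suc k k)))) ⟩
    ℕtoℚ (suc k ℕ.+ suc k)
      ≡⟨ ℕtoℚ-+ (suc k) (suc k) ⟩
    ℕtoℚ (suc k) + ℕtoℚ (suc k)
      ∎
    where
    open ≡-Reasoning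
    δ : Fin n → ℚ
    δ e = 𝟙 (does (toℕ e ℕ.≟ suc s))
    ∑δ≡1 : ∑ δ ≡ 1ℚ
    ∑δ≡1 = trans (∑-cong (λ e → sym (ℚ.*-identityˡ (δ e))))
                 (∑-indicator-toℕ (λ _ → 1ℚ) (fromℕ< (s≤s s<m)) (toℕ-fromℕ< (s≤s s<m)))

  size-exact : ∀ x → x ≤ m → size x ≡ ℕtoℚ (suc k)
  size-exact zero    _   =
    sum≡double⇒≡ (size-pair 0 (s≤s z≤n)) (size-lower 0 z≤n) (size-lower 1 (s≤s z≤n))
  size-exact (suc s) s<m =
    sum≡double⇒≡ (trans (ℚ.+-comm (size (suc s)) (size s)) (size-pair s s<m))
                 (size-lower (suc s) s<m) (size-lower s (ℕ.<⇒≤ s<m))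

  facePoint : Fin n → Fin n → ℚ
  facePoint t = point (toℕ t)

  adjacent-coordinates : ∀ (c : Fin n → ℚ) (j : Fin m) →
    ∑ (λ t → c t * facePoint t (inject₁ j)) + ∑ (λ t → c t * facePoint t (suc j))
      ≡ ∑ c + c (inject₁ j)
  adjacent-coordinates c j = begin
    ∑ (λ t → c t * facePoint t (inject₁ j)) + ∑ (λ t → c t * facePoint t (suc j))
      ≡⟨ sym (∑-distrib-+ (λ t → c t * facePoint t (inject₁ j)) (λ t → c t * facePoint t (suc j))) ⟩
    ∑ (λ t → c t * facePoint t (inject₁ j) + c t * facePoint t (suc j))
      ≡⟨ ∑-cong pair ⟩
    ∑ (λ t → c t + c t * δ t)
      ≡⟨ ∑-distrib-+ c (λ t → c t * δ t) ⟩
    ∑ c + ∑ (λ t → c t * δ t)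
      ≡⟨ cong (∑ c +_) (∑-indicator-toℕ c (inject₁ j) (toℕ-inject₁ j)) ⟩
    ∑ c + c (inject₁ j)
      ∎
    where
    open ≡-Reasoning
    δ : Fin n → ℚ
    δ t = 𝟙 (does (toℕ t ℕ.≟ toℕ j))
    pair : ∀ t → c t * facePoint t (inject₁ j) + c t * facePoint t (suc j) ≡ c t + c t * δ t
    pair t = begin
      c t * facePoint t (inject₁ j) + c t * facePoint t (suc j)
        ≡⟨ sym (ℚ.*-distribˡ-+ (c t) _ _) ⟩
      c t * (𝟙 (zigzag (toℕ t) (toℕ (inject₁ j))) + facePoint t (suc j))
        ≡⟨ cong (λ x → c t * (𝟙 (zigzag (toℕ t) x) + facePoint t (suc j))) (toℕ-inject₁ j) ⟩
      c t * (𝟙 (zigzag (toℕ t) (toℕ j)) + 𝟙 (zigzag (toℕ t) (suc (toℕ j))))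
        ≡⟨ cong (c t *_) (𝟙-zigzag-consecutive (toℕ t) (toℕ j)) ⟩
      c t * (1ℚ + δ t)
        ≡⟨ solve 2 (λ c d → c :* (con 1ℚ :+ d) := c :+ c :* d) refl (c t) (δ t) ⟩
      c t + c t * δ t
        ∎

  init-coefficient≡0 : ∀ (c : Fin n → ℚ) → ∑ c ≡ 0ℚ → (∀ e → ∑ (λ t → c t * facePoint t e) ≡ 0ℚ) →
    ∀ j → c (inject₁ j) ≡ 0ℚ
  init-coefficient≡0 c ∑c≡0 coordinate≡0 j = begin
    c (inject₁ j)
      ≡⟨ sym (ℚ.+-identityˡ (c (inject₁ j))) ⟩
    0ℚ + c (inject₁ j)
      ≡⟨ cong (_+ c (inject₁ j)) (sym ∑c≡0) ⟩
    ∑ c + c (inject₁ j)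
      ≡⟨ sym (adjacent-coordinates c j) ⟩
    ∑ (λ t → c t * facePoint t (inject₁ j)) + ∑ (λ t → c t * facePoint t (suc j))
      ≡⟨ cong₂ _+_ (coordinate≡0 (inject₁ j)) (coordinate≡0 (suc j)) ⟩
    0ℚ + 0ℚ
      ≡⟨⟩
    0ℚ
      ∎
    where open ≡-Reasoning

  face-independent : AffinelyIndependent facePoint
  face-independent c ∑c≡0 coordinate≡0 i with initLast i
  ... | init j = init-coefficient≡0 c ∑c≡0 coordinate≡0 j
  ... | last   = begin
    c (fromℕ m)                            ≡⟨ sym (ℚ.+-identityˡ (c (fromℕ m))) ⟩
    0ℚ + c (fromℕ m)                       ≡⟨ cong (_+ c (fromℕ m)) (sym ∑init≡0) ⟩
    ∑ (λ j → c (inject₁ j)) + c (fromℕ m)  ≡⟨ sym (∑-init-last c) ⟩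
    ∑ c                                    ≡⟨ ∑c≡0 ⟩
    0ℚ                                     ∎
    where
    open ≡-Reasoning
    ∑init≡0 : ∑ (λ j → c (inject₁ j)) ≡ 0ℚ
    ∑init≡0 = trans (∑-cong (init-coefficient≡0 c ∑c≡0 coordinate≡0)) (∑-zero m)

  zigzag-points : IndependentPoints (Face (MulticutPoint (Star n) (StarS n)) ones (ℕtoℚ (suc k))) n
  zigzag-points =
    facePoint ,
    (λ t → cyclicCover⇒multicutPoint _ (zigzagCut (toℕ t)) (zigzagCover (toℕ t) (toℕ≤pred[n] t)) ,
           size-exact (toℕ t) (toℕ≤pred[n] t)) ,
    face-independent

starSharedFacet : ∀ k′ → let n = suc (suc k′ ℕ.+ suc k′) in
  SharedFacet (Star n) (StarS n) ones (ℕtoℚ (suc (suc k′)))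
starSharedFacet k′ =
  facetDefining-ones cuts (⊆-Dominant ∘ ⊆-Conv) (Valid-Dominant (λ _ → ℚ.nonNegative⁻¹ 1ℚ) valid)
    allButOne-points zigzag-points ,
  facetDefining-ones cuts ⊆-Conv valid allButOne-points zigzag-points
  where
  open Zigzag k′
  open AllButOne (k′ ℕ.+ suc k′) using (allButOne-points)
  cuts = MulticutPoint (Star n) (StarS n)
  valid : Valid (Conv cuts) ones (ℕtoℚ (suc k))
  valid = Valid-Conv {a = ones} (multicutPoint-valid k)

odd⇒≡suc-double : ∀ n → n % 2 ≡ 1 → n ≡ suc (n / 2 ℕ.+ n / 2)
odd⇒≡suc-double n n%2≡1 = begin
  n                      ≡⟨ m≡m%n+[m/n]*n n 2 ⟩
  n % 2 ℕ.+ n / 2 ℕ.* 2  ≡⟨ cong₂ ℕ._+_ n%2≡1 (ℕ.*-comm (n / 2) 2) ⟩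
  1 ℕ.+ 2 ℕ.* (n / 2)    ≡⟨ cong (λ x → suc (n / 2 ℕ.+ x)) (ℕ.+-identityʳ (n / 2)) ⟩
  suc (n / 2 ℕ.+ n / 2)  ∎
  where open ≡-Reasoning

theorem5p1 : (n : ℕ) .{{_ : NonZero n}} → 3 ≤ n → n % 2 ≡ 1 →
    SharedFacet (Star n) (StarS n) ones (ℕtoℚ ⌈ n /2⌉)
theorem5p1 n 3≤n n%2≡1 with n / 2 | odd⇒≡suc-double n n%2≡1
... | zero   | refl = contradiction 3≤n λ { (s≤s ()) }
... | suc k′ | refl =
  subst (SharedFacet (Star _) (StarS _) ones ∘ ℕtoℚ) (cong suc (ℕ.n≡⌊n+n/2⌋ (suc k′)))
        (starSharedFacet k′)
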